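{- Let $\mathbf A_1,\dots,\mathbf A_n$ be finite, simple, Jónsson trivial algebras in $\mathcal V_3$, and let $\mathbf S$ be a subdirect product of the $\mathbf A_i$. Then $\mathbf S$ is almost trivial.
   Context: $\mathcal V_3$ is the class of algebras $(A;p_0,p_1,p_2,p_3)$ with ternary basic operations satisfying $p_0(x,y,z)=x$, $p_3(x,y,z)=z$, $p_i(x,y,x)=x$ for all $i$, $p_0(x,x,y)=p_1(x,x,y)$, $p_2(x,x,y)=p_3(x,x,y)$, $p_1(x,y,y)=p_2(x,y,y)$; $x\cdot y=p_1(x,y,y)$. A Jónsson ideal of $\mathbf A$ is a subuniverse $Y$ with $u\cdot y\in Y$ for all $y\in Y,u\in A$; a finite $\mathbf A\in\mathcal V_3$ is Jónsson trivial if its only Jónsson ideals are $\emptyset$ and $A$. Simple: only congruences are $0_A$ and $A^2$. A subdirect product $\mathbf S$ of $\mathbf A_1,\dots,\mathbf A_n$ is almost trivial if, after suitably rearranging the coordinates, there is a partition of $\{1,\dots,n\}$ into intervals $I_1,\dots,I_p$ such that $S=\mathrm{proj}_{I_1}(S)\times\cdots\times\mathrm{proj}_{I_p}(S)$ and, for each $j$, writing $I_j=\{i:u\le i\le v\}$, there are bijections $\pi_i:A_u\to A_i$ for $i\in I_j$ with $\mathrm{proj}_{I_j}(S)=\{(a,\pi_{u+1}(a),\dots,\pi_v(a)):a\in A_u\}$. -}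

module Defs where

open import Data.Nat using (ℕ; zero; suc)
open import Data.Fin using (Fin; zero; suc)
open import Data.Bool using (Bool; T)
open import Data.Unit using (⊤; tt)
open import Data.Empty using (⊥)
open import Data.Product using (Σ; ∃; _×_; _,_)
open import Data.Sum using (_⊎_)
open import Relation.Binary.PropositionalEquality using (_≡_)
open import Function.Definitions using (Bijective)

-- Finite algebras in V₃.  A finite algebra is represented (up to
-- isomorphism) with carrier Fin size.

Ternary : ℕ → Set
Ternary k = Fin k → Fin k → Fin k → Fin k

record V3Algebra : Set where
  field
    size : ℕ
    p₀ p₁ p₂ p₃ : Ternary size
    p₀-proj  : ∀ x y z → p₀ x y z ≡ x
    p₃-proj  : ∀ x y z → p₃ x y z ≡ z
    p₀-idem  : ∀ x y → p₀ x y x ≡ x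
    p₁-idem  : ∀ x y → p₁ x y x ≡ x
    p₂-idem  : ∀ x y → p₂ x y x ≡ x
    p₃-idem  : ∀ x y → p₃ x y x ≡ x
    p₀p₁     : ∀ x y → p₀ x x y ≡ p₁ x x y
    p₂p₃     : ∀ x y → p₂ x x y ≡ p₃ x x y
    p₁p₂     : ∀ x y → p₁ x y y ≡ p₂ x y y

  Carrier : Set
  Carrier = Fin size

  op : Fin 4 → Ternary size
  op zero = p₀
  op (suc zero) = p₁
  op (suc (suc zero)) = p₂
  op (suc (suc (suc zero))) = p₃

  _·_ : Carrier → Carrier → Carrier
  x · y = p₁ x y y

open V3Algebra public

Subset : Set → Set
Subset X = X → Bool

BinRel : Set → Set
BinRel X = X → X → Bool

module _ (A : V3Algebra) where

  IsSubuniverse : Subset (Carrier A) → Set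
  IsSubuniverse Y = ∀ (k : Fin 4) x y z →
    T (Y x) → T (Y y) → T (Y z) → T (Y (op A k x y z))

  IsJonssonIdeal : Subset (Carrier A) → Set
  IsJonssonIdeal Y = IsSubuniverse Y × (∀ u y → T (Y y) → T (Y (_·_ A u y)))

  JonssonTrivial : Set
  JonssonTrivial = ∀ Y → IsJonssonIdeal Y →
    (∀ a → T (Y a) → ⊥) ⊎ (∀ a → T (Y a))

  IsCongruence : BinRel (Carrier A) → Set
  IsCongruence θ =
    (∀ x → T (θ x x)) ×
    (∀ x y → T (θ x y) → T (θ y x)) ×
    (∀ x y z → T (θ x y) → T (θ y z) → T (θ x z)) ×
    (∀ (k : Fin 4) x x' y y' z z' → T (θ x x') → T (θ y y') → T (θ z z') →
       T (θ (op A k x y z) (op A k x' y' z')))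

  Simple : Set
  Simple = ∀ θ → IsCongruence θ →
    (∀ x y → T (θ x y) → x ≡ y) ⊎ (∀ x y → T (θ x y))

-- Tuples in the product ∏ᵢ Aᵢ of a family A : Fin n → V3Algebra,
-- represented first-order (nested pairs).

Tuple : (n : ℕ) → (Fin n → V3Algebra) → Set
Tuple zero A = ⊤
Tuple (suc n) A = Carrier (A zero) × Tuple n (λ i → A (suc i))

lookup : ∀ {n} {A : Fin n → V3Algebra} → Tuple n A → (i : Fin n) → Carrier (A i)
lookup {suc n} (a , s) zero = a
lookup {suc n} (a , s) (suc i) = lookup s i

opT : ∀ {n} {A : Fin n → V3Algebra} → Fin 4 → Tuple n A → Tuple n A → Tuple n A → Tuple n A
opT {zero} k _ _ _ = tt
opT {suc n} {A} k (a , s) (b , t) (c , u) = op (A zero) k a b c , opT k s t u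

module _ {n : ℕ} (A : Fin n → V3Algebra) where

  IsProdSubuniverse : Subset (Tuple n A) → Set
  IsProdSubuniverse S = ∀ (k : Fin 4) x y z →
    T (S x) → T (S y) → T (S z) → T (S (opT k x y z))

  IsSubdirectProduct : Subset (Tuple n A) → Set
  IsSubdirectProduct S =
    IsProdSubuniverse S ×
    (∃ λ s → T (S s)) ×
    (∀ i (a : Carrier (A i)) → ∃ λ s → T (S s) × lookup s i ≡ a)

  -- The (after rearrangement, interval) blocks of the
  -- partition are given by  block : Fin n → Fin p,  each block j having
  -- its first coordinate  rep j ; the maps π i : A_(rep (block i)) → A i
  -- are bijections.
  record AlmostTrivial (S : Subset (Tuple n A)) : Set where
    field
      p      : ℕ
      block  : Fin n → Fin p
      rep    : Fin p → Fin n
      rep-in : ∀ j → block (rep j) ≡ j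
      π      : ∀ i → Carrier (A (rep (block i))) → Carrier (A i)
      π-bij  : ∀ i → Bijective _≡_ _≡_ (π i)
      -- S = proj_{I₁}(S) × ⋯ × proj_{I_p}(S)
      product : ∀ t →
        (∀ j → ∃ λ s → T (S s) × (∀ i → block i ≡ j → lookup s i ≡ lookup t i)) →
        T (S t)
      -- proj_{I_j}(S) ⊆ {(a, π_{u+1}(a), …, π_v(a))}
      graph⊆ : ∀ s → T (S s) → ∀ i → lookup s i ≡ π i (lookup s (rep (block i)))
      -- {(a, π_{u+1}(a), …, π_v(a))} ⊆ proj_{I_j}(S)
      graph⊇ : ∀ j (a : Carrier (A (rep j))) → ∃ λ s → T (S s) × lookup s (rep j) ≡ a

module Submission where

-- Call coordinates i and j of S linked when, on S, each of them determines the
-- other.  This is a decidable equivalence, and it suffices that S projects onto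
-- every family of pairwise unlinked coordinates: taking one representative per
-- class, S is then the product of its projections onto the classes, each being
-- the graph of bijections out of the representative.
--
-- Coordinates are added one at a time.  If S projects onto L, the relation R
-- "some member of S agreeing with x on L has b at k" is compatible, so R⁻¹ ∘ R
-- is a tolerance of A k.  In a finite simple algebra some power of a tolerance
-- is a congruence, and Jónsson triviality (a nonempty fibre of R is a Jónsson
-- ideal once any two elements share a fibre) brings fullness back down to the
-- tolerance; so it is trivial or full, i.e. k is a function of L on S or S
-- projects onto k ∷ L.  If k is a function of j ∷ C, a congruence θ of A j
-- measuring how k depends on j, combined with the Jónsson terms, shows that k
-- is a function of C or j a function of k; either way S projects onto k ∷ j ∷ C.

open import Defs
open import Data.Nat using (ℕ; zero; suc; _*_; _≤_; z≤n; s≤s)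
open import Data.Nat.Properties using (<-≤-trans; <⇒≱)
open import Data.Fin using (Fin; zero; suc; #_; combine; remQuot; _≟_)
open import Data.Fin.Properties using (any?; remQuot-combine)
import Data.Fin.Subset as FinSubset
open import Data.Fin.Subset.Properties using (∣p∣≤n; p⊂q⇒∣p∣<∣q∣; _⊂?_; _∈?_)
open import Data.Bool using (Bool; T)
open import Data.Bool.Properties using (T-≡)
open import Data.Unit using (tt)
open import Data.Empty using (⊥-elim)
open import Data.Product using (∃; _×_; _,_; proj₁; proj₂; uncurry)
open import Data.Sum using (_⊎_; inj₁; inj₂; [_,_]′)
open import Data.List using (List; []; _∷_; tabulate)
open import Data.List.Relation.Unary.All as All using (All; []; _∷_)
open import Data.List.Relation.Unary.All.Properties using (anti-mono; tabulate⁻)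
open import Data.List.Relation.Unary.AllPairs using (AllPairs; []; _∷_)
import Data.List.Relation.Unary.AllPairs.Properties as AllPairs
open import Data.List.Relation.Unary.Any using (here)
open import Data.List.Relation.Binary.Subset.Propositional.Properties using (xs⊆x∷xs)
open import Data.List.Relation.Binary.Subset.Propositional using (_⊆_)
open import Data.Vec.Properties using (lookup∘tabulate; lookup⇒[]=; []=⇒lookup)
import Data.Vec as Vec
open import Function using (id; _∘_; _⇔_; mk⇔; Equivalence; Injective; Surjective)
open import Relation.Binary.PropositionalEquality
open import Relation.Nullary using (Dec; yes; no; ¬_; contradiction)
open import Relation.Nullary.Decidable using (⌊_⌋; T?; toWitness; fromWitness; _×-dec_; _→-dec_; map′; ¬?; decidable-stable)
open import Relation.Unary using (Decidable)
open import Relation.Binary.Structures using (IsDecEquivalence)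
import Relation.Binary.Construct.On as On

cong₃ : ∀ {X Y Z W : Set} (f : X → Y → Z → W) {x x′ y y′ z z′} →
  x ≡ x′ → y ≡ y′ → z ≡ z′ → f x y z ≡ f x′ y′ z′
cong₃ f refl refl refl = refl

op-absorb : (B : V3Algebra) (k : Fin 4) (x y : Carrier B) → op B k x y x ≡ x
op-absorb B zero                   = p₀-idem B
op-absorb B (suc zero)             = p₁-idem B
op-absorb B (suc (suc zero))       = p₂-idem B
op-absorb B (suc (suc (suc zero))) = p₃-idem B

op-idem : (B : V3Algebra) (k : Fin 4) (x : Carrier B) → op B k x x x ≡ x
op-idem B k x = op-absorb B k x x

p₂-xxy : (B : V3Algebra) (x y : Carrier B) → p₂ B x x y ≡ y
p₂-xxy B x y = trans (p₂p₃ B x y) (p₃-proj B x x y)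

Searchable : Set → Set₁
Searchable X = ∀ {P : X → Set} → Decidable P → Dec (∃ P)

searchable⇒all? : ∀ {X} → Searchable X → ∀ {P : X → Set} → Decidable P → Dec (∀ x → P x)
searchable⇒all? search P? with search (¬? ∘ P?)
... | yes (x , ¬Px) = no λ ∀P → ¬Px (∀P x)
... | no ∄¬P        = yes λ x → decidable-stable (P? x) (λ ¬Px → ∄¬P (x , ¬Px))

lookup-opT : ∀ {n} {A : Fin n → V3Algebra} k (x y z : Tuple n A) i →
  lookup {n} {A} (opT {n} {A} k x y z) i ≡
  op (A i) k (lookup {n} {A} x i) (lookup {n} {A} y i) (lookup {n} {A} z i)
lookup-opT {suc n} k (a , x) (b , y) (c , z) zero    = refl
lookup-opT {suc n} {A} k (a , x) (b , y) (c , z) (suc i) = lookup-opT {n} {A ∘ suc} k x y z i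

tuple-ext : ∀ {n} {A : Fin n → V3Algebra} (x y : Tuple n A) →
  (∀ i → lookup {n} {A} x i ≡ lookup {n} {A} y i) → x ≡ y
tuple-ext {zero}  tt      tt      _ = refl
tuple-ext {suc n} {A} (a , x) (b , y) x≗y =
  cong₂ _,_ (x≗y zero) (tuple-ext {n} {A ∘ suc} x y (x≗y ∘ suc))

update : ∀ {n} {A : Fin n → V3Algebra} → Tuple n A → (j : Fin n) → Carrier (A j) → Tuple n A
update {suc n} (a , x) zero    b = b , x
update {suc n} {A} (a , x) (suc j) b = a , update {n} {A ∘ suc} x j b

lookup∘update : ∀ {n} {A : Fin n → V3Algebra} (x : Tuple n A) j b →
  lookup {n} {A} (update {n} {A} x j b) j ≡ b
lookup∘update {suc n} (a , x) zero    b = refl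
lookup∘update {suc n} {A} (a , x) (suc j) b = lookup∘update {n} {A ∘ suc} x j b

lookup∘update′ : ∀ {n} {A : Fin n → V3Algebra} (x : Tuple n A) {i j} → i ≢ j → ∀ b →
  lookup {n} {A} (update {n} {A} x j b) i ≡ lookup {n} {A} x i
lookup∘update′ {suc n} (a , x) {zero}  {zero}  i≢j b = contradiction refl i≢j
lookup∘update′ {suc n} (a , x) {zero}  {suc j} i≢j b = refl
lookup∘update′ {suc n} (a , x) {suc i} {zero}  i≢j b = refl
lookup∘update′ {suc n} {A} (a , x) {suc i} {suc j} i≢j b =
  lookup∘update′ {n} {A ∘ suc} x (i≢j ∘ cong suc) b

tuple-search : ∀ {n} {A : Fin n → V3Algebra} → Searchable (Tuple n A)
tuple-search {zero}  P? = map′ (tt ,_) proj₂ (P? tt)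
tuple-search {suc n} {A} P? =
  map′ (λ (a , t , p) → (a , t) , p) (λ ((a , t) , p) → a , t , p)
       (any? λ a → tuple-search {n} {A ∘ suc} λ t → P? (a , t))

IsCompatible : (B : V3Algebra) {X : Set} → (Fin 4 → X → X → X → X) → (X → Carrier B → Bool) → Set
IsCompatible B opX R = ∀ k {x y z b b′ b″} → T (R x b) → T (R y b′) → T (R z b″) →
  T (R (opX k x y z) (op B k b b′ b″))

-- Every fibre R x is a Jónsson ideal: closure under the basic operations
-- comes from idempotence in X, and u · y = p₂(u,y,y) stays in R x by
-- applying p₂ to (c, c, x) for some c related to both u and y.
fibre-full : (B : V3Algebra) → JonssonTrivial B →
  ∀ {X} (opX : Fin 4 → X → X → X → X) →
  (∀ k x → opX k x x x ≡ x) → (∀ c x → opX (# 2) c c x ≡ x) →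
  ∀ (R : X → Carrier B → Bool) → IsCompatible B opX R →
  (∀ u b → ∃ λ c → T (R c u) × T (R c b)) →
  ∀ x {b₀} → T (R x b₀) → ∀ b → T (R x b)
fibre-full B jt opX opX-idem opX-p₂ R R-compatible linked x {b₀} xRb₀ b =
  [ (λ empty → ⊥-elim (empty b₀ xRb₀)) , (λ full → full b) ]′ (jt (R x) (closed , absorbing))
  where
  closed : IsSubuniverse B (R x)
  closed k y₁ y₂ y₃ r₁ r₂ r₃ =
    subst (λ w → T (R w (op B k y₁ y₂ y₃))) (opX-idem k x) (R-compatible k r₁ r₂ r₃)
  absorbing : ∀ u y → T (R x y) → T (R x (_·_ B u y))
  absorbing u y xRy with linked u y
  ... | c , cRu , cRy =
    subst₂ (λ w v → T (R w v)) (opX-p₂ c x) (sym (p₁p₂ B u y)) (R-compatible (# 2) cRu cRy xRy)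

-- Ascending chains of relations on a finite set

module _ {N : ℕ} where
  open FinSubset using (_⊂_; ∣_∣) renaming (Subset to Subsetᶠ; _⊆_ to _⊆ᶠ_)

  ⊆∧⊄⇒⊇ : {p q : Subsetᶠ N} → p ⊆ᶠ q → ¬ p ⊂ q → q ⊆ᶠ p
  ⊆∧⊄⇒⊇ {p} p⊆q p⊄q {x} x∈q with x ∈? p
  ... | yes x∈p = x∈p
  ... | no  x∉p = contradiction ((λ {y} → p⊆q {y}) , x , x∈q , x∉p) p⊄q

  ascending-chain-stabilises : (P : ℕ → Subsetᶠ N) → (∀ k → P k ⊆ᶠ P (suc k)) →
    ∃ λ k → P (suc k) ⊆ᶠ P k
  ascending-chain-stabilises P P-ascending =
    [ id , (λ N<∣PN+1∣ → contradiction N<∣PN+1∣ (<⇒≱ (s≤s (∣p∣≤n (P (suc N)))))) ]′ (grows (suc N))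
    where
    grows : ∀ k → (∃ λ j → P (suc j) ⊆ᶠ P j) ⊎ k ≤ ∣ P k ∣
    grows zero = inj₂ z≤n
    grows (suc k) with grows k | P k ⊂? P (suc k)
    ... | inj₁ stable | _       = inj₁ stable
    ... | inj₂ k≤∣Pk∣ | yes Pk⊂ = inj₂ (<-≤-trans (s≤s k≤∣Pk∣) (p⊂q⇒∣p∣<∣q∣ Pk⊂))
    ... | inj₂ _      | no  Pk⊄ = inj₁ (k , ⊆∧⊄⇒⊇ (P-ascending k) Pk⊄)

_⊆₂_ : ∀ {X : Set} → BinRel X → BinRel X → Set
Q ⊆₂ Q′ = ∀ {x y} → T (Q x y) → T (Q′ x y)

module _ {m : ℕ} where
  open FinSubset using () renaming (Subset to Subsetᶠ; _⊆_ to _⊆ᶠ_; _∈_ to _∈ᶠ_)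

  graph : BinRel (Fin m) → Subsetᶠ (m * m)
  graph Q = Vec.tabulate (uncurry Q ∘ remQuot m)

  ∈-graph⇔ : ∀ {Q} ij → ij ∈ᶠ graph Q ⇔ T (uncurry Q (remQuot m ij))
  ∈-graph⇔ {Q} ij = mk⇔
    (λ ij∈ → Equivalence.from T-≡ (trans (sym (lookup∘tabulate (uncurry Q ∘ remQuot m) ij)) ([]=⇒lookup ij∈)))
    (λ t → lookup⇒[]= ij (graph Q) (trans (lookup∘tabulate (uncurry Q ∘ remQuot m) ij) (Equivalence.to T-≡ t)))

  graph-mono : ∀ {Q Q′} → Q ⊆₂ Q′ → graph Q ⊆ᶠ graph Q′
  graph-mono {Q} {Q′} Q⊆Q′ {ij} =
    Equivalence.from (∈-graph⇔ {Q′} ij) ∘ Q⊆Q′ ∘ Equivalence.to (∈-graph⇔ {Q} ij)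

  graph-reflects-⊆ : ∀ {Q Q′} → graph Q ⊆ᶠ graph Q′ → Q ⊆₂ Q′
  graph-reflects-⊆ {Q} {Q′} graph⊆ {x} {y} xQy =
    subst (T ∘ uncurry Q′) (remQuot-combine x y)
      (Equivalence.to (∈-graph⇔ {Q′} (combine x y)) (graph⊆ (Equivalence.from (∈-graph⇔ {Q} (combine x y))
        (subst (T ∘ uncurry Q) (sym (remQuot-combine x y)) xQy))))

-- Tolerances of a simple Jónsson trivial algebra

module _ (B : V3Algebra) where

  IsTolerance : BinRel (Carrier B) → Set
  IsTolerance Q = (∀ x → T (Q x x)) × (∀ {x y} → T (Q x y) → T (Q y x)) × IsCompatible B (op B) Q

  Discrete Complete : BinRel (Carrier B) → Set
  Discrete Q = ∀ x y → T (Q x y) → x ≡ y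
  Complete Q = ∀ x y → T (Q x y)

  square : BinRel (Carrier B) → BinRel (Carrier B)
  square Q x z = ⌊ any? (λ y → T? (Q x y) ×-dec T? (Q y z)) ⌋

  module _ {Q : BinRel (Carrier B)} where

    square-intro : ∀ {x y z} → T (Q x y) → T (Q y z) → T (square Q x z)
    square-intro {y = y} xQy yQz = fromWitness (y , xQy , yQz)

    square-elim : ∀ {x z} → T (square Q x z) → ∃ λ y → T (Q x y) × T (Q y z)
    square-elim = toWitness

    square-tolerance : IsTolerance Q → IsTolerance (square Q)
    square-tolerance (Q-refl , Q-sym , Q-compatible) =
      (λ x → square-intro (Q-refl x) (Q-refl x)) ,
      (λ q → let (y , xQy , yQz) = square-elim q in square-intro (Q-sym yQz) (Q-sym xQy)) ,
      (λ k q₁ q₂ q₃ →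
        let (y₁ , a₁ , b₁) = square-elim q₁
            (y₂ , a₂ , b₂) = square-elim q₂
            (y₃ , a₃ , b₃) = square-elim q₃
        in square-intro (Q-compatible k a₁ a₂ a₃) (Q-compatible k b₁ b₂ b₃))

    ⊆-square : IsTolerance Q → Q ⊆₂ square Q
    ⊆-square (Q-refl , _) {y = y} xQy = square-intro xQy (Q-refl y)

    -- Completeness of Q ∘ Q gives any two elements a common Q-neighbour, so
    -- fibre-full applies to Q itself.
    square-complete⇒complete : JonssonTrivial B → IsTolerance Q → Complete (square Q) → Complete Q
    square-complete⇒complete jt (Q-refl , Q-sym , Q-compatible) complete x =
      fibre-full B jt (op B) (op-idem B) (p₂-xxy B) Q Q-compatible linked x (Q-refl x)
      where
      linked : ∀ u b → ∃ λ c → T (Q c u) × T (Q c b)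
      linked u b = let (c , uQc , cQb) = square-elim (complete u b) in c , Q-sym uQc , cQb

  squares : BinRel (Carrier B) → ℕ → BinRel (Carrier B)
  squares Q zero    = Q
  squares Q (suc k) = square (squares Q k)

  module _ {Q : BinRel (Carrier B)} (Q-tolerance : IsTolerance Q) where

    squares-tolerance : ∀ k → IsTolerance (squares Q k)
    squares-tolerance zero    = Q-tolerance
    squares-tolerance (suc k) = square-tolerance (squares-tolerance k)

    ⊆-squares : ∀ k → Q ⊆₂ squares Q k
    ⊆-squares zero    = id
    ⊆-squares (suc k) = ⊆-square (squares-tolerance k) ∘ ⊆-squares k

    squares-stabilise : ∃ λ k → square (squares Q k) ⊆₂ squares Q k
    squares-stabilise =
      let (k , stable) = ascending-chain-stabilises (graph ∘ squares Q)
                           (λ k → graph-mono {Q = squares Q k} (⊆-square (squares-tolerance k)))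
      in k , graph-reflects-⊆ {Q = square (squares Q k)} stable

    -- A stable power of Q is transitive, hence a congruence.
    stable-power-discrete-or-complete : Simple B → JonssonTrivial B →
      ∀ k → square (squares Q k) ⊆₂ squares Q k → Discrete Q ⊎ Complete Q
    stable-power-discrete-or-complete simple jt k stable =
      [ (λ discrete → inj₁ λ x y → discrete x y ∘ ⊆-squares k)
      , (λ complete → inj₂ (complete-down k complete))
      ]′ (simple (squares Q k) congruence)
      where
      congruence : IsCongruence B (squares Q k)
      congruence =
        let (Qᵏ-refl , Qᵏ-sym , Qᵏ-compatible) = squares-tolerance k in
        Qᵏ-refl , (λ _ _ → Qᵏ-sym) , (λ _ _ _ p q → stable (square-intro {squares Q k} p q)) ,
        (λ q _ _ _ _ _ _ → Qᵏ-compatible q)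
      complete-down : ∀ j → Complete (squares Q j) → Complete Q
      complete-down zero    = id
      complete-down (suc j) = complete-down j ∘ square-complete⇒complete jt (squares-tolerance j)

    tolerance-discrete-or-complete : Simple B → JonssonTrivial B → Discrete Q ⊎ Complete Q
    tolerance-discrete-or-complete simple jt =
      uncurry (stable-power-discrete-or-complete simple jt) squares-stabilise

-- R⁻¹ ∘ R is a tolerance of B (searchability of X makes it decidable); it is
-- discrete iff R is functional, and when complete fibre-full applies.
compatible-functional-or-full : (B : V3Algebra) → Simple B → JonssonTrivial B →
  ∀ {X} (opX : Fin 4 → X → X → X → X) →
  (∀ k x → opX k x x x ≡ x) → (∀ c x → opX (# 2) c c x ≡ x) → Searchable X →
  ∀ (R : X → Carrier B → Bool) → IsCompatible B opX R → (∀ b → ∃ λ x → T (R x b)) →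
  (∀ x {b b′} → T (R x b) → T (R x b′) → b ≡ b′) ⊎ (∀ x {b₀} → T (R x b₀) → ∀ b → T (R x b))
compatible-functional-or-full B simple jt opX opX-idem opX-p₂ search R R-compatible R-onto =
  [ (λ discrete → inj₁ λ x {b} {b′} xRb xRb′ → discrete b b′ (fromWitness (x , xRb , xRb′)))
  , (λ complete → inj₂ (fibre-full B jt opX opX-idem opX-p₂ R R-compatible (λ u b → toWitness (complete u b))))
  ]′ (tolerance-discrete-or-complete B R⁻¹∘R-tolerance simple jt)
  where
  R⁻¹∘R : BinRel (Carrier B)
  R⁻¹∘R b b′ = ⌊ search (λ x → T? (R x b) ×-dec T? (R x b′)) ⌋
  R⁻¹∘R-tolerance : IsTolerance B R⁻¹∘R
  R⁻¹∘R-tolerance =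
    (λ b → let (x , xRb) = R-onto b in fromWitness (x , xRb , xRb)) ,
    (λ l → let (x , xRb , xRb′) = toWitness l in fromWitness (x , xRb′ , xRb)) ,
    (λ k l₁ l₂ l₃ →
      let (x₁ , a₁ , b₁) = toWitness l₁
          (x₂ , a₂ , b₂) = toWitness l₂
          (x₃ , a₃ , b₃) = toWitness l₃
      in fromWitness (opX k x₁ x₂ x₃ , R-compatible k a₁ a₂ a₃ , R-compatible k b₁ b₂ b₃))

-- Partitions of Fin n by a decidable equivalence

record Partition {n : ℕ} (_∼_ : Fin n → Fin n → Set) : Set where
  field
    blocks       : ℕ
    block        : Fin n → Fin blocks
    rep          : Fin blocks → Fin n
    block-rep    : ∀ b → block (rep b) ≡ b
    rep-block∼   : ∀ i → rep (block i) ∼ i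
    ∼⇒same-block : ∀ {i i′} → i ∼ i′ → block i ≡ block i′

partition : ∀ {n} {_∼_ : Fin n → Fin n → Set} → IsDecEquivalence _∼_ → Partition _∼_
partition {zero} _ = record
  { blocks = 0 ; block = λ () ; rep = λ () ; block-rep = λ () ; rep-block∼ = λ () ; ∼⇒same-block = λ {} }
partition {suc n} {_∼_} ∼-isDecEquivalence
  with partition (On.isDecEquivalence suc ∼-isDecEquivalence)
     | any? (λ i → IsDecEquivalence._≟_ ∼-isDecEquivalence zero (suc i))
... | P | yes (i₀ , 0∼i₀) = record
  { blocks = blocks ; block = block′ ; rep = suc ∘ rep ; block-rep = block-rep
  ; rep-block∼ = rep-block∼′ ; ∼⇒same-block = ∼⇒same-block′ }
  where
  open IsDecEquivalence ∼-isDecEquivalence using () renaming (refl to ∼-refl; sym to ∼-sym; trans to ∼-trans)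
  open Partition P
  block′ : Fin (suc n) → Fin blocks
  block′ zero    = block i₀
  block′ (suc i) = block i
  rep-block∼′ : ∀ i → suc (rep (block′ i)) ∼ i
  rep-block∼′ zero    = ∼-trans (rep-block∼ i₀) (∼-sym 0∼i₀)
  rep-block∼′ (suc i) = rep-block∼ i
  ∼⇒same-block′ : ∀ {i i′} → i ∼ i′ → block′ i ≡ block′ i′
  ∼⇒same-block′ {zero}  {zero}   _   = refl
  ∼⇒same-block′ {zero}  {suc i′} 0∼i′ = ∼⇒same-block (∼-trans (∼-sym 0∼i₀) 0∼i′)
  ∼⇒same-block′ {suc i} {zero}   i∼0 = ∼⇒same-block (∼-trans i∼0 0∼i₀)
  ∼⇒same-block′ {suc i} {suc i′} i∼i′ = ∼⇒same-block i∼i′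
... | P | no 0≁suc = record
  { blocks = suc blocks ; block = block′ ; rep = rep′ ; block-rep = block-rep′
  ; rep-block∼ = rep-block∼′ ; ∼⇒same-block = ∼⇒same-block′ }
  where
  open IsDecEquivalence ∼-isDecEquivalence using () renaming (refl to ∼-refl; sym to ∼-sym; trans to ∼-trans)
  open Partition P
  block′ : Fin (suc n) → Fin (suc blocks)
  block′ zero    = zero
  block′ (suc i) = suc (block i)
  rep′ : Fin (suc blocks) → Fin (suc n)
  rep′ zero    = zero
  rep′ (suc b) = suc (rep b)
  block-rep′ : ∀ b → block′ (rep′ b) ≡ b
  block-rep′ zero    = refl
  block-rep′ (suc b) = cong suc (block-rep b)
  rep-block∼′ : ∀ i → rep′ (block′ i) ∼ i
  rep-block∼′ zero    = ∼-refl
  rep-block∼′ (suc i) = rep-block∼ i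
  ∼⇒same-block′ : ∀ {i i′} → i ∼ i′ → block′ i ≡ block′ i′
  ∼⇒same-block′ {zero}  {zero}   _    = refl
  ∼⇒same-block′ {zero}  {suc i′} 0∼i′ = contradiction (i′ , 0∼i′) 0≁suc
  ∼⇒same-block′ {suc i} {zero}   i∼0  = contradiction (i , ∼-sym i∼0) 0≁suc
  ∼⇒same-block′ {suc i} {suc i′} i∼i′ = cong suc (∼⇒same-block i∼i′)

-- Subdirect products

module SubdirectProduct {n : ℕ} (A : Fin n → V3Algebra) (S : Subset (Tuple n A))
                        (S-subdirect : IsSubdirectProduct A S) where

  Tup : Set
  Tup = Tuple n A

  infixl 9 _!_
  _!_ : Tup → (i : Fin n) → Carrier (A i)
  _!_ = lookup {n} {A}

  opS : Fin 4 → Tup → Tup → Tup → Tup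
  opS = opT {n} {A}

  !-opS : ∀ k x y z i → opS k x y z ! i ≡ op (A i) k (x ! i) (y ! i) (z ! i)
  !-opS = lookup-opT {n} {A}

  opS-idem : ∀ k x → opS k x x x ≡ x
  opS-idem k x = tuple-ext {n} {A} _ _ λ i → trans (!-opS k x x x i) (op-idem (A i) k (x ! i))

  opS-p₂ : ∀ c x → opS (# 2) c c x ≡ x
  opS-p₂ c x = tuple-ext {n} {A} _ _ λ i → trans (!-opS (# 2) c c x i) (p₂-xxy (A i) (c ! i) (x ! i))

  infix 4 _∈S
  _∈S : Tup → Set
  s ∈S = T (S s)

  S-closed : ∀ k {x y z} → x ∈S → y ∈S → z ∈S → opS k x y z ∈S
  S-closed k = proj₁ S-subdirect k _ _ _

  S-onto : ∀ i a → ∃ λ s → s ∈S × s ! i ≡ a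
  S-onto = proj₂ (proj₂ S-subdirect)

  infix 4 _≈[_]_
  _≈[_]_ : Tup → List (Fin n) → Tup → Set
  s ≈[ L ] t = All (λ i → s ! i ≡ t ! i) L

  ≈? : ∀ L s t → Dec (s ≈[ L ] t)
  ≈? L s t = All.all? (λ i → s ! i ≟ t ! i) L

  ≈-refl : ∀ {L s} → s ≈[ L ] s
  ≈-refl {L} = All.universal (λ _ → refl) L

  ≈-sym : ∀ {L s t} → s ≈[ L ] t → t ≈[ L ] s
  ≈-sym = All.map sym

  ≈-trans : ∀ {L s t u} → s ≈[ L ] t → t ≈[ L ] u → s ≈[ L ] u
  ≈-trans s≈t t≈u = All.zipWith (uncurry trans) (s≈t , t≈u)

  ≈-opS : ∀ {L} k {x x′ y y′ z z′} → x ≈[ L ] x′ → y ≈[ L ] y′ → z ≈[ L ] z′ →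
    opS k x y z ≈[ L ] opS k x′ y′ z′
  ≈-opS k {x} {x′} {y} {y′} {z} {z′} x≈x′ y≈y′ z≈z′ =
    All.zipWith (λ {i} (ex , ey , ez) →
                   trans (!-opS k x y z i) (trans (cong₃ (op (A i) k) ex ey ez) (sym (!-opS k x′ y′ z′ i))))
                (x≈x′ , All.zip (y≈y′ , z≈z′))

  ≈-opS-idem : ∀ {L} k {x y z t} → x ≈[ L ] t → y ≈[ L ] t → z ≈[ L ] t → opS k x y z ≈[ L ] t
  ≈-opS-idem k {t = t} x≈t y≈t z≈t = subst (_ ≈[ _ ]_) (opS-idem k t) (≈-opS k x≈t y≈t z≈t)

  ProjectsOnto : List (Fin n) → Set
  ProjectsOnto L = ∀ x → ∃ λ s → s ∈S × s ≈[ L ] x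

  Determines : List (Fin n) → Fin n → Set
  Determines L k = ∀ s s′ → s ∈S → s′ ∈S → s ≈[ L ] s′ → s ! k ≡ s′ ! k

  determines? : ∀ L k → Dec (Determines L k)
  determines? L k =
    searchable⇒all? (tuple-search {n} {A}) λ s → searchable⇒all? (tuple-search {n} {A}) λ s′ →
      T? (S s) →-dec T? (S s′) →-dec ≈? L s s′ →-dec (s ! k ≟ s′ ! k)

  onto-[] : ProjectsOnto []
  onto-[] x = let (s , s∈S) = proj₁ (proj₂ S-subdirect) in s , s∈S , []

  onto-[_] : ∀ i → ProjectsOnto (i ∷ [])
  onto-[ i ] x = let (s , s∈S , sᵢ) = S-onto i (x ! i) in s , s∈S , sᵢ ∷ []

  onto-swap : ∀ {j k L} → ProjectsOnto (j ∷ k ∷ L) → ProjectsOnto (k ∷ j ∷ L)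
  onto-swap onto x with onto x
  ... | s , s∈S , sⱼ ∷ sₖ ∷ s≈x = s , s∈S , sₖ ∷ sⱼ ∷ s≈x

  onto-extend : ∀ {i L M} → M ⊆ L → Determines M i →
    ProjectsOnto L → ProjectsOnto (i ∷ M) → ProjectsOnto (i ∷ L)
  onto-extend M⊆L M→i onto-L onto-iM x with onto-L x | onto-iM x
  ... | s , s∈S , s≈x | s′ , s′∈S , s′ᵢ ∷ s′≈x =
    s , s∈S , trans (M→i s s′ s∈S s′∈S (≈-trans (anti-mono M⊆L s≈x) (≈-sym s′≈x))) s′ᵢ ∷ s≈x

  extend-or-determined : ∀ k → Simple (A k) → JonssonTrivial (A k) →
    ∀ {L} → ProjectsOnto L → ProjectsOnto (k ∷ L) ⊎ Determines L k
  extend-or-determined k simple jt {L} onto =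
    [ (λ functional → inj₂ λ s s′ s∈S s′∈S s≈s′ →
         functional s (fromWitness (s , s∈S , ≈-refl , refl)) (fromWitness (s′ , s′∈S , ≈-sym s≈s′ , refl)))
    , (λ full → inj₁ λ x →
         let (s , s∈S , s≈x) = onto x
             (s′ , s′∈S , s′≈x , s′ₖ) =
               toWitness {a? = R? x (x ! k)} (full x (fromWitness (s , s∈S , s≈x , refl)) (x ! k))
         in s′ , s′∈S , s′ₖ ∷ s′≈x)
    ]′ (compatible-functional-or-full (A k) simple jt opS opS-idem opS-p₂ (tuple-search {n} {A})
          R R-compatible R-onto)
    where
    R? : ∀ x b → Dec (∃ λ s → s ∈S × s ≈[ L ] x × s ! k ≡ b)
    R? x b = tuple-search {n} {A} (λ s → T? (S s) ×-dec ≈? L s x ×-dec (s ! k ≟ b))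
    R : Tup → Carrier (A k) → Bool
    R x b = ⌊ R? x b ⌋
    R-compatible : IsCompatible (A k) opS R
    R-compatible q r₁ r₂ r₃ =
      let (s₁ , s₁∈S , a₁ , e₁) = toWitness r₁
          (s₂ , s₂∈S , a₂ , e₂) = toWitness r₂
          (s₃ , s₃∈S , a₃ , e₃) = toWitness r₃
      in fromWitness (opS q s₁ s₂ s₃ , S-closed q s₁∈S s₂∈S s₃∈S , ≈-opS q a₁ a₂ a₃ ,
                      trans (!-opS q s₁ s₂ s₃ k) (cong₃ (op (A k) q) e₁ e₂ e₃))
    R-onto : ∀ b → ∃ λ x → T (R x b)
    R-onto b = let (s , s∈S , sₖ) = S-onto k b in s , fromWitness (s , s∈S , ≈-refl , sₖ)

  -- The chain t = p₀(t,s,t′) ~ p₁(t,s,t′) ~ p₁(t,s′,t′) ~ p₂(t,s′,t′) ~ p₂(t,s,t′)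
  -- ~ p₃(t,s,t′) = t′ keeps the k-th coordinate: links replacing s by s′ do so
  -- because s and s′ agree at k; the other links join tuples that agree on U
  -- (by absorption, as t and t′ agree on U) and on V (by the Jónsson identities,
  -- as t, t′ coincide with s, s′ on V).
  transfer-agreement : ∀ {k U V} →
    (∀ a b → a ∈S → b ∈S → a ≈[ U ] b → a ≈[ V ] b → a ! k ≡ b ! k) →
    ∀ s s′ t t′ → s ∈S → s′ ∈S → t ∈S → t′ ∈S →
    s ≈[ U ] s′ → s ! k ≡ s′ ! k → t ≈[ V ] s → t′ ≈[ V ] s′ → t ≈[ U ] t′ → t ! k ≡ t′ ! k
  transfer-agreement {k} {U} {V} determined s s′ t t′ s∈S s′∈S t∈S t′∈S s≈s′ sₖ≡s′ₖ t≈s t′≈s′ t≈t′ =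
    begin
      t ! k              ≡⟨ sym (trans (!-opS (# 0) t s t′ k) (p₀-proj (A k) _ _ _)) ⟩
      opS (# 0) t s t′ ! k ≡⟨ link (# 0) (# 1) s∈S (λ i → p₀p₁ (A i) _ _) ⟩
      opS (# 1) t s t′ ! k ≡⟨ swap-middle (# 1) ⟩
      opS (# 1) t s′ t′ ! k ≡⟨ link (# 1) (# 2) s′∈S (λ i → p₁p₂ (A i) _ _) ⟩
      opS (# 2) t s′ t′ ! k ≡⟨ sym (swap-middle (# 2)) ⟩
      opS (# 2) t s t′ ! k ≡⟨ link (# 2) (# 3) s∈S (λ i → p₂p₃ (A i) _ _) ⟩
      opS (# 3) t s t′ ! k ≡⟨ trans (!-opS (# 3) t s t′ k) (p₃-proj (A k) _ _ _) ⟩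
      t′ ! k             ∎
    where
    open ≡-Reasoning
    ≈[U]t : ∀ q m → opS q t m t′ ≈[ U ] t
    ≈[U]t q m = All.map (λ {i} tᵢ≡t′ᵢ →
      trans (!-opS q t m t′ i) (trans (cong (op (A i) q (t ! i) (m ! i)) (sym tᵢ≡t′ᵢ)) (op-absorb (A i) q _ _))) t≈t′
    link : ∀ q q′ {m} → m ∈S →
      (∀ i → op (A i) q (s ! i) (m ! i) (s′ ! i) ≡ op (A i) q′ (s ! i) (m ! i) (s′ ! i)) →
      opS q t m t′ ! k ≡ opS q′ t m t′ ! k
    link q q′ {m} m∈S identity =
      determined _ _ (S-closed q t∈S m∈S t′∈S) (S-closed q′ t∈S m∈S t′∈S)
        (≈-trans (≈[U]t q m) (≈-sym (≈[U]t q′ m)))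
        (All.zipWith (λ {i} (tᵢ≡sᵢ , t′ᵢ≡s′ᵢ) →
           trans (!-opS q t m t′ i) (trans (cong₂ (λ u w → op (A i) q u (m ! i) w) tᵢ≡sᵢ t′ᵢ≡s′ᵢ)
             (trans (identity i) (sym (trans (!-opS q′ t m t′ i)
               (cong₂ (λ u w → op (A i) q′ u (m ! i) w) tᵢ≡sᵢ t′ᵢ≡s′ᵢ))))))
          (t≈s , t′≈s′))
    swap-middle : ∀ q → opS q t s t′ ! k ≡ opS q t s′ t′ ! k
    swap-middle q = trans (!-opS q t s t′ k)
      (trans (cong (λ w → op (A k) q (t ! k) w (t′ ! k)) sₖ≡s′ₖ) (sym (!-opS q t s′ t′ k)))

  infix 4 _∼_ _≁_
  _∼_ _≁_ : Fin n → Fin n → Set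
  i ∼ j = Determines (i ∷ []) j × Determines (j ∷ []) i
  i ≁ j = ¬ i ∼ j

  ∼-isDecEquivalence : IsDecEquivalence _∼_
  ∼-isDecEquivalence = record
    { isEquivalence = record
      { refl  = (λ _ _ _ _ → All.head) , (λ _ _ _ _ → All.head)
      ; sym   = λ (i→j , j→i) → j→i , i→j
      ; trans = λ (i→j , j→i) (j→l , l→j) →
          (λ s s′ s∈S s′∈S eᵢ → j→l s s′ s∈S s′∈S (i→j s s′ s∈S s′∈S eᵢ ∷ [])) ,
          (λ s s′ s∈S s′∈S eₗ → j→i s s′ s∈S s′∈S (l→j s s′ s∈S s′∈S eₗ ∷ []))
      }
    ; _≟_ = λ i j → determines? (i ∷ []) j ×-dec determines? (j ∷ []) i
    }

  module DeterminedCase {j k : Fin n} {C : List (Fin n)} (onto-jC : ProjectsOnto (j ∷ C))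
                        (C∌j : All (_≢ j) C) (jC→k : Determines (j ∷ C) k) where

    -- Since j ∉ C, the j-th coordinate of a member of S can be changed at will
    -- while keeping its C-coordinates; this is what makes θ a congruence.
    adjusted : ∀ t b → ∃ λ s → s ∈S × s ! j ≡ b × s ≈[ C ] t
    adjusted t b with onto-jC (update {n} {A} t j b)
    ... | s , s∈S , sⱼ ∷ s≈ = s , s∈S , trans sⱼ (lookup∘update {n} {A} t j b) ,
                              ≈-trans s≈ (All.map (λ i≢j → lookup∘update′ {n} {A} t i≢j b) C∌j)

    adjust : Tup → Carrier (A j) → Tup
    adjust t b = proj₁ (adjusted t b)

    adjust∈S : ∀ t b → adjust t b ∈S
    adjust∈S t b = proj₁ (proj₂ (adjusted t b))

    adjust-j : ∀ t b → adjust t b ! j ≡ b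
    adjust-j t b = proj₁ (proj₂ (proj₂ (adjusted t b)))

    adjust≈ : ∀ t b → adjust t b ≈[ C ] t
    adjust≈ t b = proj₂ (proj₂ (proj₂ (adjusted t b)))

    Θ : Carrier (A j) → Carrier (A j) → Set
    Θ b b′ = ∀ t t′ → t ∈S → t′ ∈S → t ! j ≡ b → t′ ! j ≡ b′ → t ≈[ C ] t′ → t ! k ≡ t′ ! k

    θ : BinRel (Carrier (A j))
    θ b b′ = ⌊ searchable⇒all? (tuple-search {n} {A}) (λ t → searchable⇒all? (tuple-search {n} {A}) λ t′ →
               T? (S t) →-dec T? (S t′) →-dec (t ! j ≟ b) →-dec (t′ ! j ≟ b′) →-dec
               ≈? C t t′ →-dec (t ! k ≟ t′ ! k)) ⌋

    θ-compatible : ∀ q {b₁ b₁′ b₂ b₂′ b₃ b₃′} → T (θ b₁ b₁′) → T (θ b₂ b₂′) → T (θ b₃ b₃′) →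
      T (θ (op (A j) q b₁ b₂ b₃) (op (A j) q b₁′ b₂′ b₃′))
    θ-compatible q {b₁} {b₁′} {b₂} {b₂′} {b₃} {b₃′} θ₁ θ₂ θ₃ = fromWitness λ t t′ t∈S t′∈S tⱼ t′ⱼ t≈t′ →
      let u = opS q (adjust t b₁) (adjust t b₂) (adjust t b₃)
          v = opS q (adjust t b₁′) (adjust t b₂′) (adjust t b₃′)
          u∈S = S-closed q (adjust∈S t b₁) (adjust∈S t b₂) (adjust∈S t b₃)
          v∈S = S-closed q (adjust∈S t b₁′) (adjust∈S t b₂′) (adjust∈S t b₃′)
          uⱼ = trans (!-opS q _ _ _ j) (cong₃ (op (A j) q) (adjust-j t b₁) (adjust-j t b₂) (adjust-j t b₃))
          vⱼ = trans (!-opS q _ _ _ j) (cong₃ (op (A j) q) (adjust-j t b₁′) (adjust-j t b₂′) (adjust-j t b₃′))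
          u≈t = ≈-opS-idem q (adjust≈ t b₁) (adjust≈ t b₂) (adjust≈ t b₃)
          v≈t = ≈-opS-idem q (adjust≈ t b₁′) (adjust≈ t b₂′) (adjust≈ t b₃′)
          at-k : ∀ {b b′} → T (θ b b′) → adjust t b ! k ≡ adjust t b′ ! k
          at-k {b} {b′} θbb′ = toWitness θbb′ _ _ (adjust∈S t b) (adjust∈S t b′) (adjust-j t b) (adjust-j t b′)
                                 (≈-trans (adjust≈ t b) (≈-sym (adjust≈ t b′)))
      in begin
        t ! k  ≡⟨ jC→k t u t∈S u∈S (trans tⱼ (sym uⱼ) ∷ ≈-sym u≈t) ⟩
        u ! k  ≡⟨ trans (!-opS q _ _ _ k) (trans (cong₃ (op (A k) q) (at-k θ₁) (at-k θ₂) (at-k θ₃))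
                                             (sym (!-opS q _ _ _ k))) ⟩
        v ! k  ≡⟨ jC→k v t′ v∈S t′∈S (trans vⱼ (sym t′ⱼ) ∷ ≈-trans v≈t t≈t′) ⟩
        t′ ! k ∎
      where open ≡-Reasoning

    θ-congruence : IsCongruence (A j) θ
    θ-congruence =
      (λ b → fromWitness λ t t′ t∈S t′∈S tⱼ t′ⱼ t≈t′ → jC→k t t′ t∈S t′∈S (trans tⱼ (sym t′ⱼ) ∷ t≈t′)) ,
      (λ b b′ θbb′ → fromWitness λ t t′ t∈S t′∈S tⱼ t′ⱼ t≈t′ →
        sym (toWitness θbb′ t′ t t′∈S t∈S t′ⱼ tⱼ (≈-sym t≈t′))) ,
      (λ b b′ b″ θbb′ θb′b″ → fromWitness λ t t″ t∈S t″∈S tⱼ t″ⱼ t≈t″ →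
        let t′ = adjust t b′ in
        trans (toWitness θbb′ t t′ t∈S (adjust∈S t b′) tⱼ (adjust-j t b′) (≈-sym (adjust≈ t b′)))
              (toWitness θb′b″ t′ t″ (adjust∈S t b′) t″∈S (adjust-j t b′) t″ⱼ (≈-trans (adjust≈ t b′) t≈t″))) ,
      (λ q _ _ _ _ _ _ → θ-compatible q)

    θ-complete⇒C→k : Complete (A j) θ → Determines C k
    θ-complete⇒C→k complete s s′ s∈S s′∈S s≈s′ = toWitness (complete (s ! j) (s′ ! j)) s s′ s∈S s′∈S refl refl s≈s′

    -- With z agreeing with x on C and with y at j, the tuples p₁(x,z,y) and
    -- p₂(x,z,y) agree at j and at k; transferring this agreement shows that
    -- w := adjust y (x ! j) agrees with x at k, and then that w ! j θ y ! j.
    θ-discrete⇒k→j : Discrete (A j) θ → Determines (k ∷ []) j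
    θ-discrete⇒k→j discrete x y x∈S y∈S (xₖ≡yₖ ∷ []) =
      trans (sym (adjust-j y (x ! j))) (discrete _ _ (fromWitness wΘy))
      where
      z w u₁ u₂ : Tup
      z = adjust x (y ! j)
      w = adjust y (x ! j)
      u₁ = opS (# 1) x z y
      u₂ = opS (# 2) x z y
      u₁ⱼ≡u₂ⱼ : u₁ ! j ≡ u₂ ! j
      u₁ⱼ≡u₂ⱼ = trans (!-opS (# 1) x z y j) (trans (cong (λ v → p₁ (A j) (x ! j) v (y ! j)) (adjust-j x (y ! j)))
        (trans (p₁p₂ (A j) _ _) (sym (trans (!-opS (# 2) x z y j)
          (cong (λ v → p₂ (A j) (x ! j) v (y ! j)) (adjust-j x (y ! j)))))))
      u₁ₖ≡u₂ₖ : u₁ ! k ≡ u₂ ! k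
      u₁ₖ≡u₂ₖ = trans (!-opS (# 1) x z y k) (trans (cong (p₁ (A k) (x ! k) (z ! k)) (sym xₖ≡yₖ))
        (trans (op-absorb (A k) (# 1) _ _) (sym (trans (!-opS (# 2) x z y k)
          (trans (cong (p₂ (A k) (x ! k) (z ! k)) (sym xₖ≡yₖ)) (op-absorb (A k) (# 2) _ _))))))
      x≈u₁ : x ≈[ C ] u₁
      x≈u₁ = All.map (λ {i} zᵢ≡xᵢ → sym (trans (!-opS (# 1) x z y i)
        (trans (cong (λ v → p₁ (A i) (x ! i) v (y ! i)) zᵢ≡xᵢ)
          (trans (sym (p₀p₁ (A i) _ _)) (p₀-proj (A i) _ _ _))))) (adjust≈ x (y ! j))
      w≈u₂ : w ≈[ C ] u₂
      w≈u₂ = All.zipWith (λ {i} (wᵢ≡yᵢ , zᵢ≡xᵢ) → trans wᵢ≡yᵢ (sym (trans (!-opS (# 2) x z y i)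
        (trans (cong (λ v → p₂ (A i) (x ! i) v (y ! i)) zᵢ≡xᵢ) (p₂-xxy (A i) _ _)))))
        (adjust≈ y (x ! j) , adjust≈ x (y ! j))
      xₖ≡wₖ : x ! k ≡ w ! k
      xₖ≡wₖ = transfer-agreement {U = j ∷ []} {V = C}
        (λ a b a∈S b∈S aⱼ a≈b → jC→k a b a∈S b∈S (All.head aⱼ ∷ a≈b))
        u₁ u₂ x w (S-closed (# 1) x∈S (adjust∈S x (y ! j)) y∈S) (S-closed (# 2) x∈S (adjust∈S x (y ! j)) y∈S)
        x∈S (adjust∈S y (x ! j)) (u₁ⱼ≡u₂ⱼ ∷ []) u₁ₖ≡u₂ₖ x≈u₁ w≈u₂ (sym (adjust-j y (x ! j)) ∷ [])
      wΘy : Θ (w ! j) (y ! j)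
      wΘy t t′ t∈S t′∈S tⱼ t′ⱼ t≈t′ = transfer-agreement {U = C} {V = j ∷ []}
        (λ a b a∈S b∈S a≈b aⱼ → jC→k a b a∈S b∈S (All.head aⱼ ∷ a≈b))
        w y t t′ (adjust∈S y (x ! j)) y∈S t∈S t′∈S (adjust≈ y (x ! j)) (trans (sym xₖ≡wₖ) xₖ≡yₖ)
        (tⱼ ∷ []) (t′ⱼ ∷ []) t≈t′

    C→k-or-k→j : Simple (A j) → Determines C k ⊎ Determines (k ∷ []) j
    C→k-or-k→j simple with simple θ θ-congruence
    ... | inj₁ discrete = inj₂ (θ-discrete⇒k→j discrete)
    ... | inj₂ complete = inj₁ (θ-complete⇒C→k complete)

  module _ (simple : ∀ i → Simple (A i)) (jt : ∀ i → JonssonTrivial (A i)) where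

    onto-pair : ∀ {k j} → k ≁ j → ProjectsOnto (k ∷ j ∷ [])
    onto-pair {k} {j} k≁j =
      [ id
      , (λ j→k → [ onto-swap , (λ k→j → contradiction (k→j , j→k) k≁j) ]′
                   (extend-or-determined j (simple j) (jt j) onto-[ k ]))
      ]′ (extend-or-determined k (simple k) (jt k) onto-[ j ])

    onto-independent₂ : ∀ k j C → AllPairs _≁_ (k ∷ j ∷ C) → ProjectsOnto (k ∷ j ∷ C)
    onto-independent₂ k j [] ((k≁j ∷ []) ∷ _) = onto-pair k≁j
    onto-independent₂ k j (l ∷ C) ((k≁j ∷ k≁lC) ∷ j≁lC ∷ ≁C) =
      [ id , by-cases ]′ (extend-or-determined k (simple k) (jt k) onto-jlC)
      where
      open IsDecEquivalence ∼-isDecEquivalence using () renaming (refl to ∼-refl; sym to ∼-sym)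
      onto-jlC : ProjectsOnto (j ∷ l ∷ C)
      onto-jlC = onto-independent₂ j l C (j≁lC ∷ ≁C)
      onto-klC : ProjectsOnto (k ∷ l ∷ C)
      onto-klC = onto-independent₂ k l C (k≁lC ∷ ≁C)
      lC∌j : All (_≢ j) (l ∷ C)
      lC∌j = All.map (λ j≁i i≡j → j≁i (subst (j ∼_) (sym i≡j) ∼-refl)) j≁lC
      by-cases : Determines (j ∷ l ∷ C) k → ProjectsOnto (k ∷ j ∷ l ∷ C)
      by-cases jlC→k = [ (λ lC→k → onto-extend (xs⊆x∷xs (l ∷ C) j) lC→k onto-jlC onto-klC)
                       , (λ k→j → onto-swap (onto-extend (λ { (here refl) → here refl }) k→j onto-klC
                                                         (onto-pair (k≁j ∘ ∼-sym))))
                       ]′ (DeterminedCase.C→k-or-k→j onto-jlC lC∌j jlC→k (simple j))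

    onto-independent : ∀ {L} → AllPairs _≁_ L → ProjectsOnto L
    onto-independent {[]}        _ = onto-[]
    onto-independent {k ∷ []}    _ = onto-[ k ]
    onto-independent {k ∷ j ∷ C}   = onto-independent₂ k j C

    almost-trivial : AlmostTrivial A S
    almost-trivial = record
      { p = blocks ; block = block ; rep = rep ; rep-in = block-rep ; π = π
      ; π-bij = λ i → π-injective i , π-surjective i
      ; product = product ; graph⊆ = graph⊆ ; graph⊇ = λ b → S-onto (rep b) }
      where
      open Partition (partition ∼-isDecEquivalence)
      π : ∀ i → Carrier (A (rep (block i))) → Carrier (A i)
      π i a = proj₁ (S-onto (rep (block i)) a) ! i
      graph⊆ : ∀ s → s ∈S → ∀ i → s ! i ≡ π i (s ! rep (block i))
      graph⊆ s s∈S i =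
        let (w , w∈S , wᵣ) = S-onto (rep (block i)) (s ! rep (block i))
        in proj₁ (rep-block∼ i) s w s∈S w∈S (sym wᵣ ∷ [])
      π-injective : ∀ i → Injective _≡_ _≡_ (π i)
      π-injective i {a} {a′} πa≡πa′ =
        let (w , w∈S , wᵣ) = S-onto (rep (block i)) a
            (w′ , w′∈S , w′ᵣ) = S-onto (rep (block i)) a′
        in trans (sym wᵣ) (trans (proj₂ (rep-block∼ i) w w′ w∈S w′∈S (πa≡πa′ ∷ [])) w′ᵣ)
      π-surjective : ∀ i → Surjective _≡_ _≡_ (π i)
      π-surjective i b =
        let (s , s∈S , sᵢ) = S-onto i b
        in s ! rep (block i) , λ { refl → trans (sym (graph⊆ s s∈S i)) sᵢ }
      onto-reps : ProjectsOnto (tabulate rep)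
      onto-reps = onto-independent (AllPairs.tabulate⁺ λ b≢b′ rep-b∼rep-b′ →
        b≢b′ (trans (sym (block-rep _)) (trans (∼⇒same-block rep-b∼rep-b′) (block-rep _))))
      product : ∀ t → (∀ b → ∃ λ s → s ∈S × (∀ i → block i ≡ b → s ! i ≡ t ! i)) → t ∈S
      product t blockwise =
        let (s , s∈S , s≈t) = onto-reps t in subst _∈S (tuple-ext {n} {A} s t (s≗t s s∈S s≈t)) s∈S
        where
        s≗t : ∀ s → s ∈S → s ≈[ tabulate rep ] t → ∀ i → s ! i ≡ t ! i
        s≗t s s∈S s≈t i =
          let (w , w∈S , w≈t) = blockwise (block i) in
          begin
            s ! i                    ≡⟨ graph⊆ s s∈S i ⟩
            π i (s ! rep (block i))  ≡⟨ cong (π i) (tabulate⁻ s≈t (block i)) ⟩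
            π i (t ! rep (block i))  ≡⟨ cong (π i) (sym (w≈t (rep (block i)) (block-rep (block i)))) ⟩
            π i (w ! rep (block i))  ≡⟨ sym (graph⊆ w w∈S i) ⟩
            w ! i                    ≡⟨ w≈t i refl ⟩
            t ! i                    ∎
          where open ≡-Reasoning

corollary3p12 : (n : ℕ) (A : Fin n → V3Algebra) →
    (∀ i → Simple (A i)) → (∀ i → JonssonTrivial (A i)) →
    (S : Subset (Tuple n A)) → IsSubdirectProduct A S →
    AlmostTrivial A S
corollary3p12 n A simple jt S S-subdirect = SubdirectProduct.almost-trivial A S S-subdirect simple jt
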